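{- For all integers $s \ge 1$ and $t \ge 1$, $|NE_{s,t}(213,123)| = t^{s-1}$.
   Context: For positive integers $s,t$, write each $x \in [st]=\{1,\dots,st\}$ uniquely as $x=(j-1)t+r$ with $1\le j\le s$ and $1\le r\le t$. The poset $NE_{s,t}$ is $[st]$ with the partial order $(j-1)t+r \preceq (j'-1)t+r'$ if and only if $j'\le j$ and $r'\le r$. A linear extension of a poset $([n],\preceq)$ is a permutation $\pi=\pi(1)\cdots\pi(n)$ of $[n]$ (one-line notation) such that whenever $a\preceq b$ and $a\ne b$, $a$ appears before $b$ in $\pi$. A permutation $\pi$ contains $\sigma$ if $\pi$ has a subsequence with the same relative order as $\sigma$, and avoids $\sigma$ otherwise. $P(\sigma_1,\dots,\sigma_k)$ denotes the set of linear extensions of the poset $P$ avoiding each of $\sigma_1,\dots,\sigma_k$. -}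

module Defs where

open import Data.Nat using (ℕ; zero; suc; _+_; _*_; _∸_; _≤_; _<_)
open import Data.Nat.DivMod using (_/_; _%_)
open import Data.List using (List; []; _∷_; length; lookup; upTo; map)
open import Data.List.Relation.Binary.Sublist.Propositional using (_⊆_)
open import Data.List.Relation.Binary.Permutation.Propositional using (_↭_)
open import Data.Fin using (Fin; _<_)
open import Data.Product using (Σ; _×_; ∃)
open import Relation.Binary.PropositionalEquality using (_≡_)
open import Relation.Nullary using (¬_)
open import Function.Bundles using (_⇔_)
open import Data.List.Relation.Unary.Unique.Propositional using (Unique)
open import Data.List.Membership.Propositional using (_∈_)

range : ℕ → List ℕ
range n = map suc (upTo n)

-- The order of NE_{s,t} on [st].  For x = (j-1)t + r with 1 ≤ j ≤ s, 1 ≤ r ≤ t,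
-- we have j - 1 = (x - 1) / t and r - 1 = (x - 1) % t.
-- x ⪯ y  iff  j_y ≤ j_x  and  r_y ≤ r_x.
NE≤ : (s t : ℕ) → .{{_ : Data.Nat.NonZero t}} → ℕ → ℕ → Set
NE≤ s t x y = ((y ∸ 1) / t ≤ (x ∸ 1) / t) × ((y ∸ 1) % t ≤ (x ∸ 1) % t)

Before : List ℕ → ℕ → ℕ → Set
Before π a b = Σ (Fin (length π)) λ i → Σ (Fin (length π)) λ j →
  (i Data.Fin.< j) × (lookup π i ≡ a) × (lookup π j ≡ b)

IsLinExt : (n : ℕ) → (ℕ → ℕ → Set) → List ℕ → Set
IsLinExt n R π = (π ↭ range n) ×
  (∀ a b → 1 ≤ a → a ≤ n → 1 ≤ b → b ≤ n → R a b → ¬ (a ≡ b) → Before π a b)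

OrderIso : (u v : List ℕ) → Set
OrderIso u v = Σ (length u ≡ length v) λ eq →
  ∀ (i j : Fin (length u)) →
    (lookup u i Data.Nat.< lookup u j) ⇔
    (lookup v (Data.Fin.cast eq i) Data.Nat.< lookup v (Data.Fin.cast eq j))

Contains : List ℕ → List ℕ → Set
Contains π σ = Σ (List ℕ) λ τ → (τ ⊆ π) × OrderIso τ σ

Avoids : List ℕ → List ℕ → Set
Avoids π σ = ¬ Contains π σ

InNE-213-123 : (s t : ℕ) → .{{_ : Data.Nat.NonZero t}} → List ℕ → Set
InNE-213-123 s t π =
  IsLinExt (s * t) (NE≤ s t) π ×
  Avoids π (2 ∷ 1 ∷ 3 ∷ []) × Avoids π (1 ∷ 2 ∷ 3 ∷ [])

HasCard : (List ℕ → Set) → ℕ → Set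
HasCard P k = Σ (List (List ℕ)) λ L →
  Unique L × (length L ≡ k) × (∀ π → (π ∈ L) ⇔ P π)

module Submission where

open import Data.Nat using (ℕ; zero; suc; _+_; _*_; _∸_; _^_; _<_; _>_; _≤_; _≤?_; _<?_; _≟_; z≤n; s≤s; z<s; s<s)
open import Data.Nat.Properties
open import Data.Nat.DivMod
  using (_/_; _%_; m≡m%n+[m/n]*n; m%n<n; /-monoˡ-≤; m*n/n≡m; m<n*o⇒m/o<n; [m+kn]%n≡m%n; m<n⇒m%n≡m)
open import Data.Fin using (Fin; zero; suc; toℕ; fromℕ<)
open import Data.Fin.Properties using (toℕ<n; toℕ-fromℕ<; toℕ-injective)
open import Data.Vec using (Vec; []; _∷_)
import Data.Vec.Properties as Vec
open import Data.List
  using (List; []; _∷_; _++_; length; lookup; map; take; drop; takeWhile; dropWhile; applyDownFrom; allFin;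
         cartesianProductWith)
open import Data.List.Properties
  using (++-assoc; ++-cancelˡ; ∷-injectiveˡ; ∷-injectiveʳ; take++drop≡id; takeWhile++dropWhile; length-++; length-++-≤ˡ;
         length-map; length-tabulate; length-applyDownFrom)
open import Data.List.Membership.Propositional using (_∈_; _∉_)
open import Data.List.Membership.Propositional.Properties
  using (∈-lookup; ∈-++⁻; ∈-++⁺ˡ; ++-∈⇔; ∈-insert; ∈-∃++; ∈-map⁺; ∈-map⁻; ∈-upTo⁺; ∈-upTo⁻; ∈-applyDownFrom⁺;
         ∈-applyDownFrom⁻; ∈-allFin; ∈-cartesianProductWith⁺)
open import Data.List.Membership.Propositional.Properties.WithK using (unique∧set⇒bag)
open import Data.List.Relation.Unary.Any using (here; there; index)
open import Data.List.Relation.Unary.Any.Properties using (lookup-index)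
open import Data.List.Relation.Unary.All as All using (All; []; _∷_)
open import Data.List.Relation.Unary.All.Properties
  using (All¬⇒¬Any; all-takeWhile) renaming (++⁺ to All-++⁺; ++⁻ to All-++⁻)
open import Data.List.Relation.Unary.AllPairs as AllPairs using (AllPairs; []; _∷_)
import Data.List.Relation.Unary.AllPairs.Properties as AllPairsₚ
open import Data.List.Relation.Unary.Unique.Propositional using (Unique)
import Data.List.Relation.Unary.Unique.Propositional.Properties as Unique
open import Data.List.Relation.Binary.Sublist.Propositional using (_⊆_; []; _∷_; _∷ʳ_; ⊆-refl; ⊆-trans; from∈; to∈)
import Data.List.Relation.Binary.Sublist.Propositional as Sublist
import Data.List.Relation.Binary.Sublist.Propositional.Properties as Sublistₚ
open import Data.List.Relation.Binary.Permutation.Propositional using (_↭_; ↭-sym; ↭-trans; ↭⇒↭ₛ)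
import Data.List.Relation.Binary.Permutation.Propositional.Properties as ↭
import Data.List.Relation.Binary.Permutation.Setoid.Properties as ↭ₛ
open import Data.List.Relation.Binary.BagAndSetEquality using (∼bag⇒↭)
open import Data.Product as Product using (Σ; _×_; _,_; proj₁; proj₂)
open import Data.Sum as Sum using (_⊎_; inj₁; inj₂)
open import Data.Sum.Function.Propositional using (_⊎-cong_)
open import Data.Empty using (⊥; ⊥-elim)
open import Function using (_∘_; id)
open import Function.Bundles using (_⇔_; mk⇔; Equivalence)
import Function.Properties.Equivalence as ⇔
open import Relation.Nullary using (¬_; yes; no)
open import Relation.Unary using (Decidable)
open import Relation.Binary.Definitions using (tri<; tri≈; tri>)
open import Relation.Binary.PropositionalEquality
  using (_≡_; _≢_; refl; sym; trans; cong; cong₂; subst; subst₂; setoid)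
open import Defs

-- Avoiding 213 and 123 together means that no entry of π is preceded by two
-- smaller entries (MaxLastFree).  In NE_{s,t} the block of the t largest
-- numbers is a chain, so a linear extension lists it in decreasing order, and
-- M = (s-1)t, the largest number of the block below, satisfies M ⪯ v for every
-- v < M, so M precedes all of them.  Once an entry smaller than M has appeared
-- after M, no entry larger than M can follow.  Hence π is the top block in
-- decreasing order with M inserted at one of t places after its first entry,
-- followed by a list ρ such that M ∷ ρ is again counted for NE_{s-1,t}; and
-- every list of this shape is counted.  So each block but the lowest
-- contributes a factor t.

private
  variable
    A : Set
    a b x : A
    xs ys π τ : List A

head∉tail : Unique (x ∷ xs) → x ∉ xs
head∉tail (x∉xs ∷ _) = All¬⇒¬Any x∉xs

Unique-⊆ : xs ⊆ ys → Unique ys → Unique xs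
Unique-⊆ [] _ = []
Unique-⊆ (_ ∷ʳ xs⊆ys) (_ ∷ u) = Unique-⊆ xs⊆ys u
Unique-⊆ (refl ∷ xs⊆ys) (x∉ys ∷ u) =
  All.tabulate (λ y∈xs → All.lookup x∉ys (Sublist.lookup xs⊆ys y∈xs)) ∷ Unique-⊆ xs⊆ys u

∈-++∷++⁻ : ∀ xs ys {zs} → x ∈ xs ++ a ∷ ys ++ zs → x ∈ xs ++ ys ⊎ x ∈ a ∷ zs
∈-++∷++⁻ [] ys (here x≡a) = inj₂ (here x≡a)
∈-++∷++⁻ [] ys (there x∈yszs) = Sum.map₂ there (∈-++⁻ ys x∈yszs)
∈-++∷++⁻ (_ ∷ xs) ys (here x≡y) = inj₁ (here x≡y)
∈-++∷++⁻ (_ ∷ xs) ys (there x∈) = Sum.map₁ there (∈-++∷++⁻ xs ys x∈)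

All-insert : ∀ {P : A → Set} xs → All P (xs ++ ys) → P x → All P (xs ++ x ∷ ys)
All-insert xs pxsys px = All-++⁺ (proj₁ (All-++⁻ xs pxsys)) (px ∷ proj₂ (All-++⁻ xs pxsys))

take-drop-++ : ∀ (xs : List A) ys → take (length xs) (xs ++ ys) ≡ xs × drop (length xs) (xs ++ ys) ≡ ys
take-drop-++ [] ys = refl , refl
take-drop-++ (x ∷ xs) ys = Product.map₁ (cong (x ∷_)) (take-drop-++ xs ys)

++⇒take-drop : ∀ {n} {xs ys zs : List A} → length zs ≡ n → xs ++ ys ≡ zs →
               Σ (Fin (suc n)) λ k → take (toℕ k) zs ≡ xs × drop (toℕ k) zs ≡ ys
++⇒take-drop {xs = xs} {ys} refl refl = fromℕ< |xs|<1+n ,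
  subst (λ n → take n (xs ++ ys) ≡ xs × drop n (xs ++ ys) ≡ ys) (sym (toℕ-fromℕ< |xs|<1+n)) (take-drop-++ xs ys)
  where |xs|<1+n = s≤s (length-++-≤ˡ xs)

take-∷-injective : ∀ {x : A} xs {m n ys zs} → x ∉ xs → m ≤ length xs → n ≤ length xs →
                   take m xs ++ x ∷ ys ≡ take n xs ++ x ∷ zs → m ≡ n × ys ≡ zs
take-∷-injective xs {zero} {zero} _ _ _ eq = refl , ∷-injectiveʳ eq
take-∷-injective (y ∷ xs) {zero} {suc n} x∉ _ _ eq = ⊥-elim (x∉ (here (∷-injectiveˡ eq)))
take-∷-injective (y ∷ xs) {suc m} {zero} x∉ _ _ eq = ⊥-elim (x∉ (here (sym (∷-injectiveˡ eq))))
take-∷-injective (y ∷ xs) {suc m} {suc n} x∉ (s≤s m≤) (s≤s n≤) eq =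
  Product.map₁ (cong suc) (take-∷-injective xs (x∉ ∘ there) m≤ n≤ (∷-injectiveʳ eq))

length-cartesianProductWith : ∀ {B C : Set} (f : A → B → C) xs ys →
  length (cartesianProductWith f xs ys) ≡ length xs * length ys
length-cartesianProductWith f [] ys = refl
length-cartesianProductWith f (x ∷ xs) ys = trans (length-++ (map (f x) ys))
  (cong₂ _+_ (length-map (f x) ys) (length-cartesianProductWith f xs ys))

allVecs : ∀ n s → List (Vec (Fin n) s)
allVecs n zero = [] ∷ []
allVecs n (suc s) = cartesianProductWith _∷_ (allFin n) (allVecs n s)

allVecs-unique : ∀ n s → Unique (allVecs n s)
allVecs-unique n zero = [] ∷ []
allVecs-unique n (suc s) = Unique.cartesianProductWith⁺ _∷_ Vec.∷-injective (Unique.allFin⁺ n) (allVecs-unique n s)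

length-allVecs : ∀ n s → length (allVecs n s) ≡ n ^ s
length-allVecs n zero = refl
length-allVecs n (suc s) = trans (length-cartesianProductWith _∷_ (allFin n) (allVecs n s))
  (cong₂ _*_ (length-tabulate {n = n} id) (length-allVecs n s))

∈-allVecs : ∀ {n s} (v : Vec (Fin n) s) → v ∈ allVecs n s
∈-allVecs [] = here refl
∈-allVecs (k ∷ v) = ∈-cartesianProductWith⁺ _∷_ (∈-allFin k) (∈-allVecs v)

-- Order of appearance: a precedes b in π iff a ∷ b ∷ [] ⊆ π

Before⇒⊆ : ∀ {π : List ℕ} {a b} → Before π a b → a ∷ b ∷ [] ⊆ π
Before⇒⊆ {x ∷ π} (zero , suc j , _ , refl , refl) = refl ∷ from∈ (∈-lookup j)
Before⇒⊆ {x ∷ π} (suc i , suc j , s≤s i<j , πi≡a , πj≡b) = x ∷ʳ Before⇒⊆ (i , j , i<j , πi≡a , πj≡b)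

⊆⇒Before : ∀ {π : List ℕ} {a b} → a ∷ b ∷ [] ⊆ π → Before π a b
⊆⇒Before (_ ∷ʳ ab⊆π) with i , j , i<j , πi≡a , πj≡b ← ⊆⇒Before ab⊆π =
  suc i , suc j , s≤s i<j , πi≡a , πj≡b
⊆⇒Before (refl ∷ b⊆π) = zero , suc (index (to∈ b⊆π)) , s≤s z≤n , refl , sym (lookup-index (to∈ b⊆π))

precedes-restrict : Unique π → τ ⊆ π → a ∈ τ → b ∈ τ → a ∷ b ∷ [] ⊆ π → a ∷ b ∷ [] ⊆ τ
precedes-restrict (_ ∷ u) (_ ∷ʳ τ⊆π) a∈τ b∈τ (_ ∷ʳ ab⊆π) = precedes-restrict u τ⊆π a∈τ b∈τ ab⊆π
precedes-restrict u (_ ∷ʳ τ⊆π) a∈τ b∈τ (refl ∷ _) = ⊥-elim (head∉tail u (Sublist.lookup τ⊆π a∈τ))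
precedes-restrict u (refl ∷ τ⊆π) a∈τ (here refl) (_ ∷ʳ ab⊆π) =
  ⊥-elim (head∉tail u (Sublist.lookup ab⊆π (there (here refl))))
precedes-restrict u (refl ∷ τ⊆π) (here refl) (there b∈τ) (_ ∷ʳ ab⊆π) =
  ⊥-elim (head∉tail u (Sublist.lookup ab⊆π (here refl)))
precedes-restrict (_ ∷ u) (refl ∷ τ⊆π) (there a∈τ) (there b∈τ) (_ ∷ʳ ab⊆π) =
  _ ∷ʳ precedes-restrict u τ⊆π a∈τ b∈τ ab⊆π
precedes-restrict u (refl ∷ τ⊆π) _ (here refl) (refl ∷ b⊆π) = ⊥-elim (head∉tail u (to∈ b⊆π))
precedes-restrict u (refl ∷ τ⊆π) _ (there b∈τ) (refl ∷ b⊆π) = refl ∷ from∈ b∈τ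

precedes-asym : Unique π → a ∷ b ∷ [] ⊆ π → b ∷ a ∷ [] ⊆ π → ⊥
precedes-asym (_ ∷ u) (_ ∷ʳ ab⊆π) (_ ∷ʳ ba⊆π) = precedes-asym u ab⊆π ba⊆π
precedes-asym u (refl ∷ _) (_ ∷ʳ ba⊆π) = head∉tail u (Sublist.lookup ba⊆π (there (here refl)))
precedes-asym u (_ ∷ʳ ab⊆π) (refl ∷ _) = head∉tail u (Sublist.lookup ab⊆π (there (here refl)))
precedes-asym u (refl ∷ b⊆π) (refl ∷ _) = head∉tail u (to∈ b⊆π)

¬precedes-head : Unique (x ∷ xs) → a ∷ x ∷ [] ⊆ x ∷ xs → ⊥
¬precedes-head u (_ ∷ʳ ax⊆xs) = head∉tail u (Sublist.lookup ax⊆xs (there (here refl)))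
¬precedes-head u (refl ∷ x⊆xs) = head∉tail u (to∈ x⊆xs)

precedes-++ : a ∈ xs → b ∈ ys → a ∷ b ∷ [] ⊆ xs ++ ys
precedes-++ a∈xs b∈ys = Sublistₚ.++⁺ (from∈ a∈xs) (from∈ b∈ys)

pair-⊆-++ : a ∷ b ∷ [] ⊆ xs ++ ys → a ∷ b ∷ [] ⊆ xs ⊎ b ∈ ys
pair-⊆-++ {xs = []} ab⊆ys = inj₂ (Sublist.lookup ab⊆ys (there (here refl)))
pair-⊆-++ {xs = x ∷ xs} (_ ∷ʳ ab⊆) = Sum.map₁ (x ∷ʳ_) (pair-⊆-++ ab⊆)
pair-⊆-++ {xs = x ∷ xs} (refl ∷ b⊆) = Sum.map₁ ((refl ∷_) ∘ from∈) (∈-++⁻ xs (to∈ b⊆))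

Within : ℕ → ℕ → ℕ → Set
Within lo hi v = lo < v × v ≤ hi

Within-split : ∀ {lo mid hi v} → lo ≤ mid → mid ≤ hi → Within lo hi v ⇔ (Within mid hi v ⊎ Within lo mid v)
Within-split {lo} {mid} {hi} {v} lo≤mid mid≤hi = mk⇔ to from
  where
  to : Within lo hi v → Within mid hi v ⊎ Within lo mid v
  to (lo<v , v≤hi) with v ≤? mid
  ... | yes v≤mid = inj₂ (lo<v , v≤mid)
  ... | no v≰mid = inj₁ (≰⇒> v≰mid , v≤hi)
  from : Within mid hi v ⊎ Within lo mid v → Within lo hi v
  from (inj₁ (mid<v , v≤hi)) = ≤-<-trans lo≤mid mid<v , v≤hi
  from (inj₂ (lo<v , v≤mid)) = lo<v , ≤-trans v≤mid mid≤hi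

∈-range⇔ : ∀ {n v} → v ∈ range n ⇔ Within 0 n v
∈-range⇔ = mk⇔ to from
  where
  to : ∀ {n v} → v ∈ range n → Within 0 n v
  to v∈ with i , i∈ , refl ← ∈-map⁻ suc v∈ = z<s , ∈-upTo⁻ i∈
  from : ∀ {n v} → Within 0 n v → v ∈ range n
  from {v = suc i} (_ , i<n) = ∈-map⁺ suc (∈-upTo⁺ i<n)

range-unique : ∀ n → Unique (range n)
range-unique n = Unique.map⁺ suc-injective (Unique.upTo⁺ n)

decreasing⇒unique : ∀ {xs} → AllPairs _>_ xs → Unique xs
decreasing⇒unique = AllPairs.map (λ x>y x≡y → <-irrefl (sym x≡y) x>y)

decreasing⇒precedes : ∀ {xs : List ℕ} {a b} → AllPairs _>_ xs → a ∈ xs → b ∈ xs → b < a → a ∷ b ∷ [] ⊆ xs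
decreasing⇒precedes _ (here refl) (here refl) b<a = ⊥-elim (<-irrefl refl b<a)
decreasing⇒precedes _ (here refl) (there b∈xs) _ = refl ∷ from∈ b∈xs
decreasing⇒precedes (x>xs ∷ _) (there a∈xs) (here refl) b<a = ⊥-elim (<-asym b<a (All.lookup x>xs a∈xs))
decreasing⇒precedes (_ ∷ d) (there a∈xs) (there b∈xs) b<a = _ ∷ʳ decreasing⇒precedes d a∈xs b∈xs b<a

precedes⇒> : ∀ {xs : List ℕ} {a b} → AllPairs _>_ xs → a ∷ b ∷ [] ⊆ xs → a > b
precedes⇒> (_ ∷ d) (_ ∷ʳ ab⊆xs) = precedes⇒> d ab⊆xs
precedes⇒> (a>xs ∷ _) (refl ∷ b⊆xs) = All.lookup a>xs (to∈ b⊆xs)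

precedes⇒decreasing : ∀ {xs : List ℕ} → Unique xs →
  (∀ {a b} → a ∈ xs → b ∈ xs → b < a → a ∷ b ∷ [] ⊆ xs) → AllPairs _>_ xs
precedes⇒decreasing {[]} _ _ = []
precedes⇒decreasing {x ∷ xs} u@(_ ∷ u′) ordered =
  All.tabulate x>y ∷ precedes⇒decreasing u′ ordered′
  where
  x>y : ∀ {y} → y ∈ xs → x > y
  x>y {y} y∈xs with <-cmp x y
  ... | tri< x<y _ _ = ⊥-elim (precedes-asym u (refl ∷ from∈ y∈xs) (ordered (there y∈xs) (here refl) x<y))
  ... | tri≈ _ refl _ = ⊥-elim (head∉tail u y∈xs)
  ... | tri> _ _ x>y = x>y
  ordered′ : ∀ {a b} → a ∈ xs → b ∈ xs → b < a → a ∷ b ∷ [] ⊆ xs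
  ordered′ a∈xs b∈xs b<a = precedes-restrict u (x ∷ʳ ⊆-refl) a∈xs b∈xs (ordered (there a∈xs) (there b∈xs) b<a)

maxima-≡ : ∀ {x y : ℕ} {xs ys} → All (x >_) xs → All (y >_) ys → x ∈ y ∷ ys → y ∈ x ∷ xs → x ≡ y
maxima-≡ _ _ (here x≡y) _ = x≡y
maxima-≡ _ _ _ (here y≡x) = sym y≡x
maxima-≡ x>xs y>ys (there x∈ys) (there y∈xs) = ⊥-elim (<-asym (All.lookup x>xs y∈xs) (All.lookup y>ys x∈ys))

decreasing-≡ : ∀ {xs ys : List ℕ} → AllPairs _>_ xs → AllPairs _>_ ys → (∀ {v} → v ∈ xs ⇔ v ∈ ys) → xs ≡ ys
decreasing-≡ {[]} {[]} _ _ _ = refl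
decreasing-≡ {[]} {y ∷ ys} _ _ same with () ← Equivalence.from same (here refl)
decreasing-≡ {x ∷ xs} {[]} _ _ same with () ← Equivalence.to same (here refl)
decreasing-≡ {x ∷ xs} {y ∷ ys} (x>xs ∷ dx) (y>ys ∷ dy) same
  with refl ← maxima-≡ x>xs y>ys (Equivalence.to same (here refl)) (Equivalence.from same (here refl)) =
  cong (x ∷_) (decreasing-≡ dx dy (mk⇔ (∈-tail x>xs (Equivalence.to same ∘ there))
                                        (∈-tail y>ys (Equivalence.from same ∘ there))))
  where
  ∈-tail : ∀ {x v : ℕ} {xs ys} → All (x >_) xs → (v ∈ xs → v ∈ x ∷ ys) → v ∈ xs → v ∈ ys
  ∈-tail x>xs f v∈xs with f v∈xs
  ... | here refl = ⊥-elim (<-irrefl refl (All.lookup x>xs v∈xs))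
  ... | there v∈ys = v∈ys

desc : ℕ → ℕ → List ℕ
desc b k = applyDownFrom (λ i → suc (i + b)) k

∈-desc⇔ : ∀ {b k v} → v ∈ desc b k ⇔ Within b (k + b) v
∈-desc⇔ {b} {k} = mk⇔ to from
  where
  to : ∀ {v} → v ∈ desc b k → Within b (k + b) v
  to v∈ with i , i<k , refl ← ∈-applyDownFrom⁻ (λ i → suc (i + b)) v∈ = s≤s (m≤n+m b i) , +-monoˡ-≤ b i<k
  from : ∀ {v} → Within b (k + b) v → v ∈ desc b k
  from {suc w} (s≤s b≤w , w<k+b) = subst (_∈ desc b k) (cong suc (m∸n+n≡m b≤w))
    (∈-applyDownFrom⁺ (λ i → suc (i + b))
      (+-cancelʳ-< b (w ∸ b) k (subst (_< k + b) (sym (m∸n+n≡m b≤w)) w<k+b)))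

desc-decreasing : ∀ b k → AllPairs _>_ (desc b k)
desc-decreasing b k = AllPairsₚ.applyDownFrom⁺₁ _ k (λ j<i _ → s<s (+-monoˡ-< b j<i))

length-desc : ∀ b k → length (desc b k) ≡ k
length-desc b k = length-applyDownFrom _ k

∉-desc : ∀ b k → b ∉ desc b k
∉-desc b k b∈ = <-irrefl refl (proj₁ (Equivalence.to ∈-desc⇔ b∈))

toℕ≤length-desc : ∀ {b n} (k : Fin (suc n)) → toℕ k ≤ length (desc b n)
toℕ≤length-desc {b} {n} k = subst (toℕ k ≤_) (sym (length-desc b n)) (≤-pred (toℕ<n k))

-- Patterns of length three

MaxLastFree : List ℕ → Set
MaxLastFree π = ∀ {x y z} → x ∷ y ∷ z ∷ [] ⊆ π → x < z → y < z → ⊥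

MaxLastFree-⊆ : ∀ {τ π : List ℕ} → τ ⊆ π → MaxLastFree π → MaxLastFree τ
MaxLastFree-⊆ τ⊆π free xyz⊆τ = free (⊆-trans xyz⊆τ τ⊆π)

MaxLastFree-∷ : ∀ {x : ℕ} {xs} → (∀ {y z} → y ∷ z ∷ [] ⊆ xs → x < z → y < z → ⊥) →
                MaxLastFree xs → MaxLastFree (x ∷ xs)
MaxLastFree-∷ head-free free (_ ∷ʳ xyz⊆xs) = free xyz⊆xs
MaxLastFree-∷ head-free free (refl ∷ yz⊆xs) = head-free yz⊆xs

decreasing⇒MaxLastFree : ∀ {xs} → AllPairs _>_ xs → MaxLastFree xs
decreasing⇒MaxLastFree d xyz⊆xs _ y<z = <-asym y<z (precedes⇒> d (Sublistₚ.∷ˡ⁻ xyz⊆xs))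

MaxLastFree-insert : ∀ xs {ys m} → AllPairs _>_ (xs ++ ys) → All (m <_) (xs ++ ys) → MaxLastFree (xs ++ m ∷ ys)
MaxLastFree-insert [] d _ =
  MaxLastFree-∷ (λ yz⊆ys _ y<z → <-asym y<z (precedes⇒> d yz⊆ys)) (decreasing⇒MaxLastFree d)
MaxLastFree-insert (x ∷ xs) (x>xsys ∷ d) (m<x ∷ m<xsys) =
  MaxLastFree-∷ (λ yz⊆ x<z _ → <-asym x<z
                   (All.lookup (All-insert xs x>xsys m<x) (Sublist.lookup yz⊆ (there (here refl)))))
                (MaxLastFree-insert xs d m<xsys)

MaxLastFree-++ : ∀ xs {ys} → MaxLastFree xs → MaxLastFree ys → (∀ {a b} → a ∈ xs → b ∈ ys → b < a) →
                 MaxLastFree (xs ++ ys)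
MaxLastFree-++ [] _ free-ys _ = free-ys
MaxLastFree-++ (w ∷ xs) free-wxs free-ys above =
  MaxLastFree-∷ head-free (MaxLastFree-++ xs (MaxLastFree-⊆ (w ∷ʳ ⊆-refl) free-wxs) free-ys (above ∘ there))
  where
  head-free : ∀ {y z} → y ∷ z ∷ [] ⊆ xs ++ _ → w < z → y < z → ⊥
  head-free yz⊆ w<z y<z with pair-⊆-++ yz⊆
  ... | inj₁ yz⊆xs = free-wxs (refl ∷ yz⊆xs) w<z y<z
  ... | inj₂ z∈ys = <-asym w<z (above (here refl) z∈ys)

MaxLastFree⇒dropWhile-below : ∀ {m} (m<? : Decidable (m <_)) xs → MaxLastFree (m ∷ xs) → m ∉ xs →
                              All (_< m) (dropWhile m<? xs)
MaxLastFree⇒dropWhile-below _ [] _ _ = []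
MaxLastFree⇒dropWhile-below {m} m<? (z ∷ xs) free m∉zxs with m<? z
... | yes _ = MaxLastFree⇒dropWhile-below m<? xs (MaxLastFree-⊆ (refl ∷ z ∷ʳ ⊆-refl) free) (m∉zxs ∘ there)
... | no m≮z = z<m ∷ All.tabulate v<m
  where
  z<m : z < m
  z<m = ≤∧≢⇒< (≮⇒≥ m≮z) (λ { refl → m∉zxs (here refl) })
  v<m : ∀ {v} → v ∈ xs → v < m
  v<m v∈xs = ≤∧≢⇒< (≮⇒≥ (λ m<v → free (refl ∷ refl ∷ from∈ v∈xs) m<v (<-trans z<m m<v)))
                    (λ { refl → m∉zxs (there v∈xs) })

data SameOrder (a b a′ b′ : ℕ) : Set where
  both< : a < b → a′ < b′ → SameOrder a b a′ b′
  both≡ : a ≡ b → a′ ≡ b′ → SameOrder a b a′ b′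
  both> : b < a → b′ < a′ → SameOrder a b a′ b′

SameOrder-flip : ∀ {a b a′ b′} → SameOrder a b a′ b′ → SameOrder b a b′ a′
SameOrder-flip (both< a<b a′<b′) = both> a<b a′<b′
SameOrder-flip (both≡ a≡b a′≡b′) = both≡ (sym a≡b) (sym a′≡b′)
SameOrder-flip (both> b<a b′<a′) = both< b<a b′<a′

SameOrder⇒<⇔< : ∀ {a b a′ b′} → SameOrder a b a′ b′ → (a < b) ⇔ (a′ < b′)
SameOrder⇒<⇔< (both< a<b a′<b′) = mk⇔ (λ _ → a′<b′) (λ _ → a<b)
SameOrder⇒<⇔< (both≡ refl refl) =
  mk⇔ (λ a<a → ⊥-elim (<-irrefl refl a<a)) (λ a′<a′ → ⊥-elim (<-irrefl refl a′<a′))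
SameOrder⇒<⇔< (both> b<a b′<a′) =
  mk⇔ (λ a<b → ⊥-elim (<-asym a<b b<a)) (λ a′<b′ → ⊥-elim (<-asym a′<b′ b′<a′))

orderIso₃ : ∀ {x y z x′ y′ z′} → SameOrder x y x′ y′ → SameOrder x z x′ z′ → SameOrder y z y′ z′ →
            OrderIso (x ∷ y ∷ z ∷ []) (x′ ∷ y′ ∷ z′ ∷ [])
orderIso₃ xy xz yz = refl , λ where
  zero zero → SameOrder⇒<⇔< (both≡ refl refl)
  zero (suc zero) → SameOrder⇒<⇔< xy
  zero (suc (suc zero)) → SameOrder⇒<⇔< xz
  (suc zero) zero → SameOrder⇒<⇔< (SameOrder-flip xy)
  (suc zero) (suc zero) → SameOrder⇒<⇔< (both≡ refl refl)
  (suc zero) (suc (suc zero)) → SameOrder⇒<⇔< yz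
  (suc (suc zero)) zero → SameOrder⇒<⇔< (SameOrder-flip xz)
  (suc (suc zero)) (suc zero) → SameOrder⇒<⇔< (SameOrder-flip yz)
  (suc (suc zero)) (suc (suc zero)) → SameOrder⇒<⇔< (both≡ refl refl)

Avoids⇒MaxLastFree : ∀ {π} → Unique π → Avoids π (2 ∷ 1 ∷ 3 ∷ []) → Avoids π (1 ∷ 2 ∷ 3 ∷ []) → MaxLastFree π
Avoids⇒MaxLastFree {π} u avoids-213 avoids-123 {x} {y} {z} xyz⊆π x<z y<z with <-cmp x y
... | tri< x<y _ _ =
  avoids-123 (_ , xyz⊆π , orderIso₃ (both< x<y (s<s z<s)) (both< x<z (s<s z<s)) (both< y<z (s<s (s<s z<s))))
... | tri≈ _ refl _ = head∉tail (Unique-⊆ xyz⊆π u) (here refl)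
... | tri> _ _ y<x =
  avoids-213 (_ , xyz⊆π , orderIso₃ (both> y<x (s<s z<s)) (both< x<z (s<s (s<s z<s))) (both< y<z (s<s z<s)))

MaxLastFree⇒Avoids : ∀ {π a b c} → MaxLastFree π → a < c → b < c → Avoids π (a ∷ b ∷ c ∷ [])
MaxLastFree⇒Avoids free a<c b<c (x ∷ y ∷ z ∷ [] , xyz⊆π , refl , iso) =
  free xyz⊆π (Equivalence.from (iso zero (suc (suc zero))) a<c)
             (Equivalence.from (iso (suc zero) (suc (suc zero))) b<c)

-- The poset NE_{s+1,t+1}

-- Blocks and columns are numbered from 0: v = 1 + column v + block v * T.
module Layout (t : ℕ) where

  T : ℕ
  T = suc t

  block column : ℕ → ℕ
  block v = (v ∸ 1) / T
  column v = (v ∸ 1) % T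

  _≼_ : ℕ → ℕ → Set
  a ≼ b = block b ≤ block a × column b ≤ column a

  top : ℕ → ℕ
  top B = suc B * T

  InBlock : ℕ → ℕ → Set
  InBlock B = Within (B * T) (top B)

  column<T : ∀ v → column v < T
  column<T v = m%n<n (v ∸ 1) T

  block-mono : ∀ {a b} → a ≤ b → block a ≤ block b
  block-mono a≤b = /-monoˡ-≤ T (∸-monoˡ-≤ 1 a≤b)

  block-InBlock : ∀ B {v} → InBlock B v → block v ≡ B
  block-InBlock B {suc w} (s≤s B*T≤w , w<top) = ≤-antisym
    (≤-pred (m<n*o⇒m/o<n w<top))
    (subst (_≤ w / T) (m*n/n≡m B T) (/-monoˡ-≤ T B*T≤w))

  InBlock-decompose : ∀ B {v} → InBlock B v → v ≡ suc (column v + B * T)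
  InBlock-decompose B {suc w} inB =
    cong suc (trans (m≡m%n+[m/n]*n w T) (cong (λ b → w % T + b * T) (block-InBlock B inB)))

  top-InBlock : ∀ B → InBlock B (top B)
  top-InBlock B = s≤s (m≤n+m (B * T) t) , ≤-refl

  block-top : ∀ B → block (top B) ≡ B
  block-top B = block-InBlock B (top-InBlock B)

  column-top : ∀ B → column (top B) ≡ t
  column-top B = trans ([m+kn]%n≡m%n t B T) (m<n⇒m%n≡m ≤-refl)

  column-≤⇔ : ∀ B {a b} → InBlock B a → InBlock B b → column b ≤ column a ⇔ b ≤ a
  column-≤⇔ B {a} {b} inA inB = mk⇔
    (λ cb≤ca → subst₂ _≤_ (sym (InBlock-decompose B inB)) (sym (InBlock-decompose B inA))
                          (s≤s (+-monoˡ-≤ (B * T) cb≤ca)))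
    (λ b≤a → +-cancelʳ-≤ (B * T) (column b) (column a)
               (≤-pred (subst₂ _≤_ (InBlock-decompose B inB) (InBlock-decompose B inA) b≤a)))

  ≼⇔≥-InBlock : ∀ B {a b} → InBlock B a → InBlock B b → a ≼ b ⇔ b ≤ a
  ≼⇔≥-InBlock B inA inB = mk⇔
    (λ a≼b → Equivalence.to (column-≤⇔ B inA inB) (proj₂ a≼b))
    (λ b≤a → ≤-reflexive (trans (block-InBlock B inB) (sym (block-InBlock B inA))) ,
             Equivalence.from (column-≤⇔ B inA inB) b≤a)

  ≼⇒>-InBlock : ∀ B {a b} → InBlock B a → InBlock B b → a ≼ b → a ≢ b → b < a
  ≼⇒>-InBlock B inA inB a≼b a≢b = ≤∧≢⇒< (Equivalence.to (≼⇔≥-InBlock B inA inB) a≼b) (a≢b ∘ sym)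

  top-≼ : ∀ B {v} → v ≤ top B → top B ≼ v
  top-≼ B {v} v≤top = block-mono v≤top ,
                      subst (column v ≤_) (sym (column-top B)) (≤-pred (column<T v))

  ¬≼-next-block : ∀ B {a b} → a ≤ top B → InBlock (suc B) b → a ≼ b → ⊥
  ¬≼-next-block B {a} {b} a≤top inB (b≤a , _) = 1+n≰n (begin
    suc B         ≡⟨ sym (block-InBlock (suc B) inB) ⟩
    block b       ≤⟨ b≤a ⟩
    block a       ≤⟨ block-mono a≤top ⟩
    block (top B) ≡⟨ block-top B ⟩
    B             ∎)
    where open ≤-Reasoning

  ≼-top⇒top : ∀ B {a} → InBlock (suc B) a → a ≼ top B → a ≡ top (suc B)
  ≼-top⇒top B {a} inA (_ , t≤ca) = trans (InBlock-decompose (suc B) inA) (cong (λ c → suc (c + top B)) ca≡t)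
    where
    ca≡t : column a ≡ t
    ca≡t = ≤-antisym (≤-pred (column<T a)) (subst (_≤ column a) (column-top B) t≤ca)

  Respects≼ : List ℕ → Set
  Respects≼ σ = ∀ {a b} → a ∈ σ → b ∈ σ → a ≼ b → a ≢ b → a ∷ b ∷ [] ⊆ σ

  Respects≼-⊆ : ∀ {τ π} → Unique π → τ ⊆ π → Respects≼ π → Respects≼ τ
  Respects≼-⊆ u τ⊆π respects a∈τ b∈τ a≼b a≢b =
    precedes-restrict u τ⊆π a∈τ b∈τ (respects (Sublist.lookup τ⊆π a∈τ) (Sublist.lookup τ⊆π b∈τ) a≼b a≢b)

  record Valid (s : ℕ) (π : List ℕ) : Set where
    field
      unique      : Unique π
      elements    : ∀ {v} → v ∈ π ⇔ Within 0 (top s) v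
      extends     : Respects≼ π
      maxLastFree : MaxLastFree π

  Valid-⊆ : ∀ {s s′ τ π} → Valid s′ π → τ ⊆ π → (∀ {v} → v ∈ τ ⇔ Within 0 (top s) v) → Valid s τ
  Valid-⊆ valid τ⊆π τ-elements = record
    { unique      = Unique-⊆ τ⊆π unique
    ; elements    = τ-elements
    ; extends     = Respects≼-⊆ unique τ⊆π extends
    ; maxLastFree = MaxLastFree-⊆ τ⊆π maxLastFree
    }
    where open Valid valid

  InNE⇒Valid : ∀ s {π} → InNE-213-123 (suc s) T π → Valid s π
  InNE⇒Valid s ((π↭range , before) , avoids-213 , avoids-123) = record
    { unique      = unique
    ; elements    = ⇔.trans (mk⇔ (↭.∈-resp-↭ π↭range) (↭.∈-resp-↭ (↭-sym π↭range))) ∈-range⇔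
    ; extends     = λ a∈π b∈π a≼b a≢b →
        Before⇒⊆ (before _ _ (proj₁ (bounds a∈π)) (proj₂ (bounds a∈π))
                             (proj₁ (bounds b∈π)) (proj₂ (bounds b∈π)) a≼b a≢b)
    ; maxLastFree = Avoids⇒MaxLastFree unique avoids-213 avoids-123
    }
    where
    unique = ↭ₛ.Unique-resp-↭ (setoid ℕ) (↭⇒↭ₛ (↭-sym π↭range)) (range-unique _)
    bounds : ∀ {v} → v ∈ _ → Within 0 (top s) v
    bounds v∈π = Equivalence.to ∈-range⇔ (↭.∈-resp-↭ π↭range v∈π)

  Valid⇒InNE : ∀ s {π} → Valid s π → InNE-213-123 (suc s) T π
  Valid⇒InNE s valid =
    ( ∼bag⇒↭ (unique∧set⇒bag unique (range-unique _) (⇔.trans elements (⇔.sym ∈-range⇔)))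
    , λ a b 0<a a≤top 0<b b≤top a≼b a≢b →
        ⊆⇒Before (extends (Equivalence.from elements (0<a , a≤top))
                          (Equivalence.from elements (0<b , b≤top)) a≼b a≢b))
    , MaxLastFree⇒Avoids maxLastFree (s<s (s<s z<s)) (s<s z<s)
    , MaxLastFree⇒Avoids maxLastFree (s<s z<s) (s<s (s<s z<s))
    where open Valid valid

  desc-block-extends : ∀ B → Respects≼ (desc (B * T) T)
  desc-block-extends B a∈ b∈ a≼b a≢b = decreasing⇒precedes (desc-decreasing _ T) a∈ b∈
    (≼⇒>-InBlock B (Equivalence.to ∈-desc⇔ a∈) (Equivalence.to ∈-desc⇔ b∈) a≼b a≢b)

  ≡desc-block : ∀ B {σ} → Unique σ → (∀ {v} → v ∈ σ ⇔ InBlock B v) → Respects≼ σ → σ ≡ desc (B * T) T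
  ≡desc-block B {σ} u elements extends =
    decreasing-≡ (precedes⇒decreasing u ordered) (desc-decreasing _ T) (⇔.trans elements (⇔.sym ∈-desc⇔))
    where
    ordered : ∀ {a b} → a ∈ σ → b ∈ σ → b < a → a ∷ b ∷ [] ⊆ σ
    ordered a∈ b∈ b<a = extends a∈ b∈
      (Equivalence.from (≼⇔≥-InBlock B (Equivalence.to elements a∈) (Equivalence.to elements b∈)) (<⇒≤ b<a))
      (λ a≡b → <-irrefl (sym a≡b) b<a)

  Valid-base : Valid 0 (desc 0 T)
  Valid-base = record
    { unique      = decreasing⇒unique (desc-decreasing 0 T)
    ; elements    = ∈-desc⇔
    ; extends     = desc-block-extends 0
    ; maxLastFree = decreasing⇒MaxLastFree (desc-decreasing 0 T)
    }

  Valid-base⇒≡ : ∀ {π} → Valid 0 π → π ≡ desc 0 T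
  Valid-base⇒≡ valid = ≡desc-block 0 unique elements extends
    where open Valid valid

  module Insertion (s : ℕ) {X Y ρ : List ℕ} (U≡desc : top (suc s) ∷ X ++ Y ≡ desc (top s) T)
                   (lower : Valid s (top s ∷ ρ)) where
    private
      module L = Valid lower

    M N : ℕ
    M = top s
    N = top (suc s)

    U P : List ℕ
    U = N ∷ X ++ Y
    P = N ∷ X ++ M ∷ Y

    U-decreasing : AllPairs _>_ U
    U-decreasing = subst (AllPairs _>_) (sym U≡desc) (desc-decreasing M T)

    ∈U⇔ : ∀ {v} → v ∈ U ⇔ InBlock (suc s) v
    ∈U⇔ {v} = subst (λ L → v ∈ L ⇔ InBlock (suc s) v) (sym U≡desc) ∈-desc⇔

    P↭MU : P ↭ M ∷ U
    P↭MU = ↭.shift M (N ∷ X) Y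

    π↭ : P ++ ρ ↭ U ++ M ∷ ρ
    π↭ = ↭-trans (↭.++⁺ʳ ρ P↭MU) (↭-sym (↭.shift M U ρ))

    disjoint : ∀ {v} → ¬ (v ∈ U × v ∈ M ∷ ρ)
    disjoint (v∈U , v∈Mρ) = <⇒≱ (proj₁ (Equivalence.to ∈U⇔ v∈U)) (proj₂ (Equivalence.to L.elements v∈Mρ))

    ρ-below : ∀ {v} → v ∈ ρ → v < M
    ρ-below v∈ρ = ≤∧≢⇒< (proj₂ (Equivalence.to L.elements (there v∈ρ))) (λ { refl → head∉tail L.unique v∈ρ })

    P-above-ρ : ∀ {a b} → a ∈ P → b ∈ ρ → b < a
    P-above-ρ a∈P b∈ρ with ↭.∈-resp-↭ P↭MU a∈P
    ... | here refl = ρ-below b∈ρ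
    ... | there a∈U = <-trans (ρ-below b∈ρ) (proj₁ (Equivalence.to ∈U⇔ a∈U))

    Mρ⊆π : M ∷ ρ ⊆ P ++ ρ
    Mρ⊆π = N ∷ʳ Sublistₚ.++⁺ (from∈ (∈-insert X)) ⊆-refl

    U⊆P : U ⊆ P
    U⊆P = refl ∷ Sublistₚ.++⁺ (⊆-refl {x = X}) (M ∷ʳ ⊆-refl)

    extends : Respects≼ (P ++ ρ)
    extends a∈π b∈π a≼b a≢b
      with Equivalence.to ++-∈⇔ (↭.∈-resp-↭ π↭ a∈π) | Equivalence.to ++-∈⇔ (↭.∈-resp-↭ π↭ b∈π)
    ... | inj₂ a∈Mρ | inj₂ b∈Mρ = ⊆-trans (L.extends a∈Mρ b∈Mρ a≼b a≢b) Mρ⊆π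
    ... | inj₂ a∈Mρ | inj₁ b∈U =
      ⊥-elim (¬≼-next-block s (proj₂ (Equivalence.to L.elements a∈Mρ)) (Equivalence.to ∈U⇔ b∈U) a≼b)
    ... | inj₁ a∈U | inj₁ b∈U = ⊆-trans (decreasing⇒precedes U-decreasing a∈U b∈U
      (≼⇒>-InBlock (suc s) (Equivalence.to ∈U⇔ a∈U) (Equivalence.to ∈U⇔ b∈U) a≼b a≢b)) (Sublistₚ.++⁺ʳ ρ U⊆P)
    ... | inj₁ a∈U | inj₂ (here refl) rewrite ≼-top⇒top s (Equivalence.to ∈U⇔ a∈U) a≼b =
      refl ∷ from∈ (∈-++⁺ˡ (∈-insert X))
    ... | inj₁ a∈U | inj₂ (there b∈ρ) = precedes-++ (Sublist.lookup U⊆P a∈U) b∈ρ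

    valid : Valid (suc s) (P ++ ρ)
    valid = record
      { unique      = ↭ₛ.Unique-resp-↭ (setoid ℕ) (↭⇒↭ₛ (↭-sym π↭))
                        (Unique.++⁺ (decreasing⇒unique U-decreasing) L.unique disjoint)
      ; elements    = ⇔.trans (mk⇔ (↭.∈-resp-↭ π↭) (↭.∈-resp-↭ (↭-sym π↭)))
                        (⇔.trans ++-∈⇔
                          (⇔.trans (∈U⇔ ⊎-cong L.elements) (⇔.sym (Within-split z≤n (m≤n+m M T)))))
      ; extends     = extends
      ; maxLastFree = MaxLastFree-++ P
                        (MaxLastFree-insert (N ∷ X) U-decreasing (All.tabulate (proj₁ ∘ Equivalence.to ∈U⇔)))
                        (MaxLastFree-⊆ (M ∷ʳ ⊆-refl) L.maxLastFree) P-above-ρ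
      }

  Valid-step : ∀ s {X Y ρ} → top (suc s) ∷ X ++ Y ≡ desc (top s) T → Valid s (top s ∷ ρ) →
               Valid (suc s) (top (suc s) ∷ X ++ top s ∷ Y ++ ρ)
  Valid-step s {X} {Y} {ρ} U≡desc lower =
    subst (Valid (suc s)) (cong (top (suc s) ∷_) (++-assoc X (top s ∷ Y) ρ)) (Insertion.valid s U≡desc lower)

  split-at-top : ∀ s {π} → Valid (suc s) π →
    Σ (List ℕ) λ A → Σ (List ℕ) λ C → Σ (List ℕ) λ ρ →
      π ≡ A ++ top s ∷ C ++ ρ × All (top s <_) (A ++ C) × All (_< top s) ρ
  split-at-top s valid
    with A , B , refl ← ∈-∃++ (Equivalence.from (Valid.elements valid) (z<s , m≤n+m (top s) T)) =
    A , takeWhile (M <?_) B , dropWhile (M <?_) B ,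
    cong (λ B → A ++ M ∷ B) (sym (takeWhile++dropWhile (M <?_) B)) ,
    All-++⁺ (All.tabulate A-above) (all-takeWhile (M <?_) B) ,
    MaxLastFree⇒dropWhile-below (M <?_) B (MaxLastFree-⊆ MB⊆π maxLastFree) (head∉tail (Unique-⊆ MB⊆π unique))
    where
    open Valid valid
    M : ℕ
    M = top s
    MB⊆π : M ∷ B ⊆ A ++ M ∷ B
    MB⊆π = Sublistₚ.++⁺ˡ A ⊆-refl
    A-above : ∀ {v} → v ∈ A → M < v
    A-above {v} v∈A with v ≤? M | v ≟ M
    ... | no v≰M | _ = ≰⇒> v≰M
    ... | yes _ | yes refl = ⊥-elim (precedes-asym unique vM⊆π vM⊆π)
      where vM⊆π = precedes-++ v∈A (here refl)
    ... | yes v≤M | no v≢M = ⊥-elim (precedes-asym unique vM⊆π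
      (extends (Sublist.lookup MB⊆π (here refl)) (∈-++⁺ˡ v∈A) (top-≼ s v≤M) (v≢M ∘ sym)))
      where vM⊆π = precedes-++ v∈A (here refl)

  record Layered (s : ℕ) (π : List ℕ) : Set where
    field
      X Y ρ  : List ℕ
      block≡ : top (suc s) ∷ X ++ Y ≡ desc (top s) T
      π≡     : π ≡ top (suc s) ∷ X ++ top s ∷ Y ++ ρ
      lower  : Valid s (top s ∷ ρ)

  split⇒Layered : ∀ s A C ρ → Valid (suc s) (A ++ top s ∷ C ++ ρ) →
                  All (top s <_) (A ++ C) → All (_< top s) ρ → Layered s (A ++ top s ∷ C ++ ρ)
  split⇒Layered s [] C ρ valid _ _ = ⊥-elim (¬precedes-head unique
    (extends (Equivalence.from elements (z<s , ≤-refl)) (here refl) (top-≼ (suc s) (m≤n+m (top s) T)) N≢M))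
    where
    open Valid valid
    N≢M : top (suc s) ≢ top s
    N≢M = >⇒≢ (m<n+m (top s) z<s)
  split⇒Layered s (a ∷ X) C ρ valid above below = record
    { X = X ; Y = C ; ρ = ρ
    ; block≡ = trans (cong (_∷ X ++ C) (sym a≡N)) AC≡desc
    ; π≡     = cong (λ a → a ∷ X ++ M ∷ C ++ ρ) a≡N
    ; lower  = Valid-⊆ valid Mρ⊆π Mρ-elements
    }
    where
    open Valid valid
    M : ℕ
    M = top s
    aX : List ℕ
    aX = a ∷ X
    AC⊆π : aX ++ C ⊆ aX ++ M ∷ C ++ ρ
    AC⊆π = Sublistₚ.++⁺ (⊆-refl {x = aX}) (M ∷ʳ Sublistₚ.++⁺ʳ ρ ⊆-refl)
    Mρ⊆π : M ∷ ρ ⊆ aX ++ M ∷ C ++ ρ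
    Mρ⊆π = Sublistₚ.++⁺ˡ aX (refl ∷ Sublistₚ.++⁺ˡ C ⊆-refl)
    Mρ-bound : ∀ {v} → v ∈ M ∷ ρ → v ≤ M
    Mρ-bound (here refl) = ≤-refl
    Mρ-bound (there v∈ρ) = <⇒≤ (All.lookup below v∈ρ)
    AC-elements : ∀ {v} → v ∈ aX ++ C ⇔ InBlock (suc s) v
    AC-elements = mk⇔
      (λ v∈AC → All.lookup above v∈AC , proj₂ (Equivalence.to elements (Sublist.lookup AC⊆π v∈AC)))
      (λ (M<v , v≤N) → Sum.[ id , (λ v∈Mρ → ⊥-elim (<⇒≱ M<v (Mρ-bound v∈Mρ))) ]
                         (∈-++∷++⁻ aX C (Equivalence.from elements (≤-<-trans z≤n M<v , v≤N))))
    Mρ-elements : ∀ {v} → v ∈ M ∷ ρ ⇔ Within 0 M v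
    Mρ-elements = mk⇔
      (λ v∈Mρ → proj₁ (Equivalence.to elements (Sublist.lookup Mρ⊆π v∈Mρ)) , Mρ-bound v∈Mρ)
      (λ (0<v , v≤M) → Sum.[ (λ v∈AC → ⊥-elim (<⇒≱ (All.lookup above v∈AC) v≤M)) , id ]
                         (∈-++∷++⁻ aX C (Equivalence.from elements (0<v , ≤-trans v≤M (m≤n+m M T)))))
    AC≡desc : aX ++ C ≡ desc M T
    AC≡desc = ≡desc-block (suc s) (Unique-⊆ AC⊆π unique) AC-elements (Respects≼-⊆ unique AC⊆π extends)
    a≡N : a ≡ top (suc s)
    a≡N = ∷-injectiveˡ AC≡desc

  Valid⇒Layered : ∀ s {π} → Valid (suc s) π → Layered s π
  Valid⇒Layered s valid with A , C , ρ , refl , above , below ← split-at-top s valid =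
    split⇒Layered s A C ρ valid above below

  -- k ∷ c places top s after the first 1 + toℕ k entries of the block above it.
  perm-tail : (s : ℕ) → Vec (Fin T) s → List ℕ
  perm-tail zero [] = desc 0 t
  perm-tail (suc s) (k ∷ c) =
    take (toℕ k) (desc (top s) t) ++ top s ∷ drop (toℕ k) (desc (top s) t) ++ perm-tail s c

  perm : (s : ℕ) → Vec (Fin T) s → List ℕ
  perm s c = top s ∷ perm-tail s c

  perm-valid : ∀ s c → Valid s (perm s c)
  perm-valid zero [] = Valid-base
  perm-valid (suc s) (k ∷ c) =
    Valid-step s (cong (top (suc s) ∷_) (take++drop≡id (toℕ k) (desc (top s) t))) (perm-valid s c)

  Valid⇒perm : ∀ s {π} → Valid s π → Σ (Vec (Fin T) s) λ c → π ≡ perm s c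
  Valid⇒perm zero valid = [] , Valid-base⇒≡ valid
  Valid⇒perm (suc s) valid
    with record { X = X ; Y = Y ; ρ = ρ ; block≡ = block≡ ; π≡ = refl ; lower = lower } ← Valid⇒Layered s valid
    with c , Mρ≡ ← Valid⇒perm s lower
    with k , refl , refl ← ++⇒take-drop {xs = X} {ys = Y} (length-desc (top s) t) (∷-injectiveʳ block≡)
    = k ∷ c , cong (λ ρ → top (suc s) ∷ X ++ top s ∷ Y ++ ρ) (∷-injectiveʳ Mρ≡)

  perm-injective : ∀ s {c c′} → perm s c ≡ perm s c′ → c ≡ c′
  perm-injective zero {[]} {[]} _ = refl
  perm-injective (suc s) {k ∷ c} {k′ ∷ c′} eq
    with k≡k′ , tails≡ ← take-∷-injective (desc (top s) t) (∉-desc (top s) t)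
                           (toℕ≤length-desc k) (toℕ≤length-desc k′) (∷-injectiveʳ eq)
    with refl ← toℕ-injective k≡k′
    = cong (k ∷_) (perm-injective s (cong (top s ∷_) (++-cancelˡ (drop (toℕ k) _) _ _ tails≡)))

corollary3p7 : (s t : ℕ) → HasCard (InNE-213-123 (suc s) (suc t)) (suc t ^ s)
corollary3p7 s t =
  map (perm s) (allVecs T s) ,
  Unique.map⁺ (perm-injective s) (allVecs-unique T s) ,
  trans (length-map (perm s) (allVecs T s)) (length-allVecs T s) ,
  λ π → mk⇔ (listed⇒InNE π) (λ π∈NE → listed (Valid⇒perm s (InNE⇒Valid s π∈NE)))
  where
  open Layout t
  listed⇒InNE : ∀ π → π ∈ map (perm s) (allVecs T s) → InNE-213-123 (suc s) T π
  listed⇒InNE π π∈ with c , _ , refl ← ∈-map⁻ (perm s) π∈ = Valid⇒InNE s (perm-valid s c)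
  listed : ∀ {π} → Σ (Vec (Fin T) s) (λ c → π ≡ perm s c) → π ∈ map (perm s) (allVecs T s)
  listed (c , refl) = ∈-map⁺ (perm s) (∈-allVecs c)
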